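{- Let $G=(V,E)$ be a connected non-trivial graph and let $t\ge 2$ be an integer. For any $x\in V$ and any $w,w'\in V^{t-1}$, $$d_{S(G,t)}(xw,xw')=d_{S(G,t-1)}(w,w').$$
   Context: For a graph $G=(V,E)$ and a positive integer $t$, $V^t$ denotes the set of words of length $t$ over the alphabet $V$; concatenation of words $u,v$ is written $uv$, and $x^k$ denotes the word consisting of $k$ copies of the letter $x$. The generalized Sierpiński graph $S(G,t)$ has vertex set $V^t$ and edge set $\{\{w u_i u_j^{d-1}, w u_j u_i^{d-1}\} : \{u_i,u_j\}\in E,\ d\in\{1,\dots,t\},\ w\in V^{t-d}\}$. In particular $S(G,1)=G$. $d_H$ denotes the shortest-path distance in a graph $H$. -}

module Defs where

open import Data.Nat using (ℕ; zero; suc; _+_; _≤_)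
open import Data.Fin using (Fin)
open import Data.Vec using (Vec; _∷_; _++_; replicate; cast)
open import Data.Product using (Σ; ∃; _×_)
open import Relation.Binary.PropositionalEquality using (_≡_)
open import Relation.Nullary using (¬_)

record Graph : Set₁ where
  field
    n     : ℕ
    Adj   : Fin n → Fin n → Set
    sym   : ∀ {u v} → Adj u v → Adj v u
    irrefl : ∀ {u} → ¬ Adj u u

data Walk {A : Set} (R : A → A → Set) : A → A → ℕ → Set where
  here : ∀ {a} → Walk R a a zero
  step : ∀ {a b c k} → R a b → Walk R b c k → Walk R a c (suc k)

IsDistance : {A : Set} → (A → A → Set) → A → A → ℕ → Set
IsDistance R a b d = Walk R a b d × (∀ k → Walk R a b k → d ≤ k)

Connected : Graph → Set
Connected G = ∀ u v → ∃ λ k → Walk (Graph.Adj G) u v k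

NonTrivial : Graph → Set
NonTrivial G = 2 ≤ Graph.n G

-- Adjacency in the generalized Sierpinski graph S(G,t):
-- a = w u_i u_j^{d-1}, b = w u_j u_i^{d-1}, with {u_i,u_j} ∈ E,
-- w ∈ V^{t-d}; here k = t - d and e = d - 1.
record SAdj (G : Graph) (t : ℕ) (a b : Vec (Fin (Graph.n G)) t) : Set where
  field
    k e : ℕ
    len : k + suc e ≡ t
    w   : Vec (Fin (Graph.n G)) k
    ui uj : Fin (Graph.n G)
    edge : Graph.Adj G ui uj
    eqa : a ≡ cast len (w ++ (ui ∷ replicate e uj))
    eqb : b ≡ cast len (w ++ (uj ∷ replicate e ui))

-- A walk in S(G,t+1) between two words starting with x either stays in the
-- copy xV^t, where it is a walk of S(G,t), or leaves it. The only edges between copies are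
-- {a c^t, c a^t}, so by induction on the walk: a walk from a∷u to b∷v either yields walks
-- u → v and a^t → b^t, or walks u → b^t and a^t → v plus one crossing edge, of total length
-- at most its own. For a = b = x the second case is itself a walk u → x^t → v, so distances
-- within a copy never shrink.
module Submission where

open import Defs
open import Data.Nat using (ℕ; zero; suc; pred; _+_; _≤_; z≤n; s≤s)
open import Data.Nat.Properties using (≤-trans; ≤-antisym; +-comm; m≤n⇒m≤1+n; m≤m+n; n≤1+n)
open import Data.Fin using (Fin)
open import Data.Vec using (Vec; []; _∷_; replicate; cast)
open import Data.Vec.Properties using (cast-is-id; ∷-injectiveˡ; ∷-injectiveʳ)
open import Data.Product using (∃; _×_; _,_)
open import Relation.Binary.PropositionalEquality using (_≡_; refl; sym; trans; cong; subst)
open import Function.Bundles using (_⇔_; mk⇔)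

module _ {A : Set} {R : A → A → Set} where

  _++ʷ_ : ∀ {a b c k l} → Walk R a b k → Walk R b c l → Walk R a c (k + l)
  here     ++ʷ q = q
  step r p ++ʷ q = step r (p ++ʷ q)

  IsDistance-⇔ : {B : Set} {S : B → B → Set} {a b : A} {a' b' : B} →
                 (∀ {k} → Walk R a b k → Walk S a' b' k) →
                 (∀ {k} → Walk S a' b' k → ∃ λ k' → Walk R a b k' × k' ≤ k) →
                 ∀ d → IsDistance S a' b' d ⇔ IsDistance R a b d
  IsDistance-⇔ {S = S} {a} {b} {a'} {b'} embed shorten d = mk⇔ to from
    where
    to : IsDistance S a' b' d → IsDistance R a b d
    to (p , minimal) with shorten p
    ... | k , q , k≤d = subst (Walk R a b) (≤-antisym k≤d (minimal k (embed q))) q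
                      , λ k q' → minimal k (embed q')
    from : IsDistance R a b d → IsDistance S a' b' d
    from (q , minimal) = embed q , λ k p → let (k' , q' , k'≤k) = shorten p in ≤-trans (minimal k' q') k'≤k

Walk-map : ∀ {A B : Set} {R : A → A → Set} {S : B → B → Set} (f : A → B) →
           (∀ {a b} → R a b → S (f a) (f b)) →
           ∀ {a b k} → Walk R a b k → Walk S (f a) (f b) k
Walk-map f f-hom here       = here
Walk-map f f-hom (step r p) = step (f-hom r) (Walk-map f f-hom p)

cast-replicate : ∀ {A : Set} {m n} (eq : m ≡ n) (x : A) → cast eq (replicate m x) ≡ replicate n x
cast-replicate refl x = cast-is-id refl _

module _ (G : Graph) where
  open Graph G using (n)

  SAdj-∷ : ∀ {t} x {u v : Vec (Fin n) t} → SAdj G t u v → SAdj G (suc t) (x ∷ u) (x ∷ v)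
  SAdj-∷ x s = record
    { k = suc k ; e = e ; len = cong suc len ; w = x ∷ w ; ui = ui ; uj = uj ; edge = edge
    ; eqa = cong (x ∷_) eqa ; eqb = cong (x ∷_) eqb }
    where open SAdj s

  data SAdj-∷-View {t} (a : Fin n) (u : Vec (Fin n) t) : Fin n → Vec (Fin n) t → Set where
    within : ∀ {v} → SAdj G t u v → SAdj-∷-View a u a v
    across : ∀ c → u ≡ replicate t c → SAdj-∷-View a u c (replicate t a)

  view-SAdj-∷ : ∀ {t a b} {u v : Vec (Fin n) t} → SAdj G (suc t) (a ∷ u) (b ∷ v) → SAdj-∷-View a u b v
  view-SAdj-∷ {t} record { k = zero ; e = e ; len = len ; w = [] ; ui = ui ; uj = uj ; eqa = eqa ; eqb = eqb }
    with ∷-injectiveˡ eqa | ∷-injectiveˡ eqb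
  ... | refl | refl =
    subst (SAdj-∷-View ui _ uj) (sym (tail-is-replicate eqb))
          (across uj (tail-is-replicate eqa))
    where
    tail-is-replicate : ∀ {y z} {u : Vec (Fin n) t} → y ∷ u ≡ cast len (y ∷ replicate e z) → u ≡ replicate t z
    tail-is-replicate {z = z} eq = trans (∷-injectiveʳ eq) (cast-replicate (cong pred len) z)
  view-SAdj-∷ record { k = suc k ; e = e ; len = len ; w = y ∷ w ; ui = ui ; uj = uj ; edge = edge ; eqa = eqa ; eqb = eqb }
    with ∷-injectiveˡ eqa | ∷-injectiveˡ eqb
  ... | refl | refl = within record
    { k = k ; e = e ; len = cong pred len ; w = w ; ui = ui ; uj = uj ; edge = edge
    ; eqa = ∷-injectiveʳ eqa ; eqb = ∷-injectiveʳ eqb }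

  data TailWalks {t} (a : Fin n) (u : Vec (Fin n) t) (b : Fin n) (v : Vec (Fin n) t) (L : ℕ) : Set where
    direct : ∀ {k₁ k₂} → Walk (SAdj G t) u v k₁ → Walk (SAdj G t) (replicate t a) (replicate t b) k₂ →
             k₁ + k₂ ≤ L → TailWalks a u b v L
    crossed : ∀ {k₁ k₂} → Walk (SAdj G t) u (replicate t b) k₁ → Walk (SAdj G t) (replicate t a) v k₂ →
              suc (k₁ + k₂) ≤ L → TailWalks a u b v L

  tailWalks-of : ∀ {t a b L} {u v : Vec (Fin n) t} → Walk (SAdj G (suc t)) (a ∷ u) (b ∷ v) L → TailWalks a u b v L
  tailWalks-of here = direct here here z≤n
  tailWalks-of {L = suc L} (step {b = _ ∷ _} r p) with view-SAdj-∷ r | tailWalks-of p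
  ... | within s      | direct  q₁ q₂ le = direct  (step s q₁) q₂ (s≤s le)
  ... | within s      | crossed q₁ q₂ le = crossed (step s q₁) q₂ (s≤s le)
  ... | across c refl | direct  {k₁} {k₂} q₁ q₂ le =
        crossed q₂ q₁ (s≤s (subst (_≤ L) (+-comm k₁ k₂) le))
  ... | across c refl | crossed {k₁} {k₂} q₁ q₂ le =
        direct q₂ q₁ (m≤n⇒m≤1+n (≤-trans (n≤1+n _) (subst (λ m → suc m ≤ L) (+-comm k₁ k₂) le)))

  shorten-in-copy : ∀ {t x L} {u v : Vec (Fin n) t} → Walk (SAdj G (suc t)) (x ∷ u) (x ∷ v) L →
                    ∃ λ k → Walk (SAdj G t) u v k × k ≤ L
  shorten-in-copy p with tailWalks-of p
  ... | direct  {k₁} {k₂} q₁ q₂ le = k₁ , q₁ , ≤-trans (m≤m+n k₁ k₂) le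
  ... | crossed {k₁} {k₂} q₁ q₂ le = k₁ + k₂ , q₁ ++ʷ q₂ , ≤-trans (n≤1+n _) le

lemma1 : (G : Graph) → Connected G → NonTrivial G →
         (t : ℕ) → 1 ≤ t →
         (x : Fin (Graph.n G)) (w w' : Vec (Fin (Graph.n G)) t) (d : ℕ) →
         IsDistance (SAdj G (suc t)) (x ∷ w) (x ∷ w') d ⇔ IsDistance (SAdj G t) w w' d
lemma1 G _ _ t _ x w w' =
  IsDistance-⇔ (Walk-map (x ∷_) (SAdj-∷ G x)) (shorten-in-copy G)
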